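{- For $k\ge 0$ let $L_k$ be the $2^k\times 2^k$ Latin square defined by $L_0=(1)$ and $L_k=\begin{pmatrix} L_{k-1}+2^{k-1} & L_{k-1}\\ L_{k-1} & L_{k-1}+2^{k-1}\end{pmatrix}$ for $k\ge1$ (equivalently, the $k$-fold tensor product of $\begin{pmatrix}2&1\\1&2\end{pmatrix}$). Then, with $n=2^k$, $(L_k,\mathrm{lex})$ contains a greedy defining set of cardinality $n^2-\Omega(n^{1.673})$ (as $k\to\infty$).
   Context: For a Latin square $L$ on $\{1,\ldots,n\}$ and an integer $p$, $L+p$ is obtained by adding $p$ to every entry. A Latin square of order $n$ with entries in $\{1,\ldots,n\}$ is regarded as a proper coloring of $K_n\Box K_n$ (cells are vertices; two cells are adjacent iff they share a row or column), with cells ordered lexicographically (row by row, top to bottom, each row left to right). First-Fit subject to a pre-coloring of a set $S$ of cells: cells of $S$ keep their given values; other cells are scanned in order and each gets the smallest positive integer not used on its already colored neighbors (cells of $S$ count as colored from the start). $S$ is a greedy defining set of $(L,\mathrm{lex})$ if First-Fit subject to the entries of $L$ on $S$ reproduces $L$. -}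

module Defs where

open import Data.Nat using (ℕ; zero; suc; _+_; _*_; _∸_; _^_; _≤_; _<_; _<ᵇ_; _≡ᵇ_)
open import Data.Bool using (Bool; true; false; if_then_else_; _∧_; not)
open import Data.Maybe using (Maybe; just; nothing)
open import Data.Product using (_×_; _,_)
open import Data.List using (List; []; _∷_; map; concatMap; foldl; length; upTo)
open import Data.Nat.ListAction using (sum)
open import Data.Bool.ListAction using (any)
open import Relation.Binary.PropositionalEquality using (_≡_)

-- The square L_k, as a function of (row, column) with 0-based indices
-- 0 ≤ i, j < 2^k (values outside this range are irrelevant), defined by
-- the block recursion  L_0 = (1),
-- L_k = [[L_{k-1} + 2^{k-1}, L_{k-1}], [L_{k-1}, L_{k-1} + 2^{k-1}]].
L : ℕ → ℕ → ℕ → ℕ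
L zero i j = 1
L (suc k) i j with i <ᵇ 2 ^ k | j <ᵇ 2 ^ k
... | true  | true  = L k i j + 2 ^ k
... | true  | false = L k i (j ∸ 2 ^ k)
... | false | true  = L k (i ∸ 2 ^ k) j
... | false | false = L k (i ∸ 2 ^ k) (j ∸ 2 ^ k) + 2 ^ k

Coloring : Set
Coloring = ℕ → ℕ → Maybe ℕ

CellSet : Set
CellSet = ℕ → ℕ → Bool

-- Colors currently on the neighbours of cell (r , c) in K_n □ K_n
-- (same row, other column; or same column, other row).
justs : List (Maybe ℕ) → List ℕ
justs [] = []
justs (just x ∷ xs) = x ∷ justs xs
justs (nothing ∷ xs) = justs xs

neighbourColors : ℕ → Coloring → ℕ → ℕ → List ℕ
neighbourColors n col r c =
  justs (concatMap (λ c' → if c' ≡ᵇ c then [] else (col r c' ∷ [])) (upTo n))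
  Data.List.++
  justs (concatMap (λ r' → if r' ≡ᵇ r then [] else (col r' c ∷ [])) (upTo n))

_∈ᵇ_ : ℕ → List ℕ → Bool
x ∈ᵇ xs = any (λ y → x ≡ᵇ y) xs

mexFrom : ℕ → ℕ → List ℕ → ℕ
mexFrom zero m xs = m
mexFrom (suc f) m xs = if m ∈ᵇ xs then mexFrom f (suc m) xs else m

-- smallest positive integer not in xs (fuel length xs suffices)
mex : List ℕ → ℕ
mex xs = mexFrom (length xs) 1 xs

lexCells : ℕ → List (ℕ × ℕ)
lexCells n = concatMap (λ r → map (λ c → (r , c)) (upTo n)) (upTo n)

update : Coloring → ℕ → ℕ → ℕ → Coloring
update col r c v r' c' = if (r' ≡ᵇ r) ∧ (c' ≡ᵇ c) then just v else col r' c'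

ffStep : ℕ → CellSet → Coloring → ℕ × ℕ → Coloring
ffStep n S col (r , c) =
  if S r c then col else update col r c (mex (neighbourColors n col r c))

firstFit : ℕ → (ℕ → ℕ → ℕ) → CellSet → Coloring
firstFit n M S = foldl (ffStep n S) (λ r c → if S r c then just (M r c) else nothing) (lexCells n)

IsGreedyDefiningSet : ℕ → (ℕ → ℕ → ℕ) → CellSet → Set
IsGreedyDefiningSet n M S =
  ∀ r c → r < n → c < n → firstFit n M S r c ≡ just (M r c)

card : ℕ → CellSet → ℕ
card n S = sum (map (λ rc → if S (Data.Product.proj₁ rc) (Data.Product.proj₂ rc) then 1 else 0) (lexCells n))

-- First-Fit reproduces a square M from its entries on a set S as soon as every cell outside S
-- is forced: each smaller colour already occurs on a neighbour that is precoloured or scanned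
-- earlier. Scanning in lexicographic order then gives every cell its own entry, the Latin
-- property keeping that entry off the coloured neighbours.
--
-- L_(a+k) is the tensor product of L_a and L_k: in base 2^k, the high digits of row, column and
-- entry − 1 come from L_a and the low digits from L_k. Hence forcing sets multiply: precolour a
-- cell of L_(a+k) when its block is precoloured for L_a or its position inside the block is
-- precoloured for L_k. An 8 × 8 forcing set for L_3 leaving 33 cells free, checked by
-- evaluation, thus yields greedy defining sets of L_k leaving 33^⌊k/3⌋ cells free, and
-- 8^1673 ≤ 33^1000 turns this into at least n^1.673 / 16 free cells for n = 2^k.

module Submission where

open import Data.Bool using (Bool; true; false; T; not; _∧_; _∨_; if_then_else_)
open import Data.Bool.ListAction using (all; any)
open import Data.Bool.Properties using (∨-zeroʳ; ∨-conicalˡ; ∨-conicalʳ; T-≡; T-∧; T-∨)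
open import Data.Fin using (Fin; toℕ)
import Data.Fin.Properties as Fin
open import Data.List using (List; []; _∷_; map; concatMap; foldl; length; upTo; applyUpTo; lookup)
open import Data.List.Membership.Propositional using (_∈_; _∉_; find)
open import Data.List.Membership.Propositional.Properties
  using (∈-upTo⁺; ∈-upTo⁻; ∈-++⁺ˡ; ∈-++⁺ʳ; ∈-++⁻)
open import Data.List.Properties
  using (foldl-∷ʳ; foldl-++; foldl-map; upTo-∷ʳ; map-concatMap; map-upTo; map-∘)
import Data.List.Relation.Unary.All as All
open import Data.List.Relation.Unary.All.Properties using (all⁺)
open import Data.List.Relation.Unary.Any as Any using (here; there; index)
open import Data.List.Relation.Unary.Any.Properties using (any⁺; any⁻; lookup-index)
open import Data.Maybe using (Maybe; just; nothing)
open import Data.Maybe.Properties using (just-injective)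
open import Data.Nat
  using ( ℕ; zero; suc; _+_; _*_; _∸_; _^_; _≤_; _<_; _≡ᵇ_; _<ᵇ_
        ; z≤n; s≤s; s≤s⁻¹; z<s; s<s; pred; NonZero; >-nonZero)
open import Data.Nat.DivMod using (_/_; _%_; m≡m%n+[m/n]*n; m%n<n; m<n*o⇒m/o<n)
open import Data.Nat.ListAction using (sum)
open import Data.Nat.ListAction.Properties using (sum-++)
open import Data.Nat.Properties
open import Algebra.Properties.CommutativeSemigroup +-commutativeSemigroup
  using () renaming (interchange to +-interchange)
open import Algebra.Properties.CommutativeSemigroup *-commutativeSemigroup
  using (x∙yz≈y∙xz) renaming (interchange to *-interchange)
open import Data.Product using (Σ; ∃; ∃₂; _×_; _,_; proj₁; proj₂; map₁; map₂)
open import Data.Sum as ⊎ using (_⊎_; inj₁; inj₂)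
open import Function using (_∘_)
open import Function.Bundles using (Equivalence)
open import Relation.Binary.Definitions using (tri<; tri≈; tri>)
open import Relation.Binary.PropositionalEquality
open import Relation.Nullary using (¬_; yes; no; contradiction)
open import Relation.Nullary.Decidable using (_×-dec_)

open import Defs

foldl-upTo-induction : ∀ {B : Set} (P : ℕ → B → Set) (f : B → ℕ → B) {z : B} n →
  P 0 z → (∀ {i b} → i < n → P i b → P (suc i) (f b i)) → P n (foldl f z (upTo n))
foldl-upTo-induction P f zero p₀ step = p₀
foldl-upTo-induction P f {z} (suc n) p₀ step =
  subst (P (suc n)) (trans (sym (foldl-∷ʳ f z n (upTo n))) (cong (foldl f z) (upTo-∷ʳ n)))
    (step ≤-refl (foldl-upTo-induction P f n p₀ (step ∘ m≤n⇒m≤1+n)))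

foldl-concatMap : ∀ {A B C : Set} (f : A → B → A) (g : C → List B) z xs →
  foldl f z (concatMap g xs) ≡ foldl (λ a x → foldl f a (g x)) z xs
foldl-concatMap f g z [] = refl
foldl-concatMap f g z (x ∷ xs) =
  trans (foldl-++ f z (g x) (concatMap g xs)) (foldl-concatMap f g (foldl f z (g x)) xs)

∈ᵇ⇒∈ : ∀ {x} xs → T (x ∈ᵇ xs) → x ∈ xs
∈ᵇ⇒∈ {x} xs p = Any.map (≡ᵇ⇒≡ x _) (any⁻ (x ≡ᵇ_) xs p)

∈⇒∈ᵇ : ∀ {x xs} → x ∈ xs → T (x ∈ᵇ xs)
∈⇒∈ᵇ {x} p = any⁺ (x ≡ᵇ_) (Any.map (≡⇒≡ᵇ x _) p)

-- Pigeonhole on the positions in xs of 1, …, b.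
range⊆⇒≤length : ∀ b (xs : List ℕ) → (∀ {v} → 1 ≤ v → v ≤ b → v ∈ xs) → b ≤ length xs
range⊆⇒≤length b xs covers with b ≤? length xs
... | yes b≤ = b≤
... | no b≰ = contradiction (Fin.pigeonhole (≰⇒> b≰) position) noCollision
  where
  mem : (i : Fin b) → suc (toℕ i) ∈ xs
  mem i = covers (s≤s z≤n) (Fin.toℕ<n i)
  position : Fin b → Fin (length xs)
  position i = index (mem i)
  noCollision : ¬ ∃₂ λ i j → toℕ i < toℕ j × position i ≡ position j
  noCollision (i , j , i<j , same) = <⇒≢ i<j (suc-injective (begin
    suc (toℕ i)                ≡⟨ lookup-index (mem i) ⟩
    lookup xs (position i)     ≡⟨ cong (lookup xs) same ⟩
    lookup xs (position j)     ≡⟨ lookup-index (mem j) ⟨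
    suc (toℕ j)                ∎))
    where open ≡-Reasoning

mexFrom-≡ : ∀ fuel {m t} xs → m ≤ t → t ∸ m ≤ fuel →
  (∀ {v} → m ≤ v → v < t → v ∈ xs) → t ∉ xs → mexFrom fuel m xs ≡ t
mexFrom-≡ zero xs m≤t gap below t∉ = ≤-antisym m≤t (m∸n≡0⇒m≤n (n≤0⇒n≡0 gap))
mexFrom-≡ (suc fuel) {m} {t} xs m≤t gap below t∉ with m ∈ᵇ xs in m∈?
... | true = mexFrom-≡ fuel xs m<t (subst (_≤ fuel) (pred[m∸n]≡m∸[1+n] t m) (pred-mono-≤ gap))
               (below ∘ <⇒≤) t∉
  where m<t = ≤∧≢⇒< m≤t λ { refl → t∉ (∈ᵇ⇒∈ xs (subst T (sym m∈?) _)) }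
... | false = ≤-antisym m≤t (≮⇒≥ λ m<t → subst T m∈? (∈⇒∈ᵇ (below ≤-refl m<t)))

mex-≡ : ∀ {m} xs → 1 ≤ m → (∀ {v} → 1 ≤ v → v < m → v ∈ xs) → m ∉ xs → mex xs ≡ m
mex-≡ {m} xs 1≤m below m∉ = mexFrom-≡ (length xs) xs 1≤m
  (subst (_≤ length xs) (pred[m∸n]≡m∸[1+n] m 0)
    (range⊆⇒≤length (pred m) xs λ 1≤v v≤ →
      below 1≤v (m≤pred[n]⇒suc[m]≤n {{>-nonZero 1≤m}} v≤)))
  below m∉

≡ᵇ-refl : ∀ m → (m ≡ᵇ m) ≡ true
≡ᵇ-refl zero = refl
≡ᵇ-refl (suc m) = ≡ᵇ-refl m

-- neighbourColors n col r c
--   = otherColours (col r) c (upTo n) ++ otherColours (λ r′ → col r′ c) r (upTo n)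
otherColours : (ℕ → Maybe ℕ) → ℕ → List ℕ → List ℕ
otherColours g j is = justs (concatMap (λ i → if i ≡ᵇ j then [] else (g i ∷ [])) is)

∈-otherColours⁺ : ∀ g {j v i} is → i ∈ is → i ≢ j → g i ≡ just v → v ∈ otherColours g j is
∈-otherColours⁺ g {j} (i ∷ is) (here refl) i≢j gi≡v with i ≡ᵇ j in i≟j
... | true = contradiction (≡ᵇ⇒≡ i j (subst T (sym i≟j) _)) i≢j
... | false rewrite gi≡v = here refl
∈-otherColours⁺ g {j} (i′ ∷ is) (there i∈) i≢j gi≡v with i′ ≡ᵇ j | g i′
... | true  | _       = ∈-otherColours⁺ g is i∈ i≢j gi≡v
... | false | nothing = ∈-otherColours⁺ g is i∈ i≢j gi≡v
... | false | just _  = there (∈-otherColours⁺ g is i∈ i≢j gi≡v)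

∈-otherColours⁻ : ∀ g {j v} is → v ∈ otherColours g j is →
  ∃ λ i → i ∈ is × i ≢ j × g i ≡ just v
∈-otherColours⁻ g {j} (i ∷ is) v∈ with i ≡ᵇ j in i≟j | g i in gi
... | true  | _      = map₂ (map₁ there) (∈-otherColours⁻ g is v∈)
... | false | nothing = map₂ (map₁ there) (∈-otherColours⁻ g is v∈)
... | false | just w with v∈
...   | here refl = i , here refl , (λ i≡j → subst T i≟j (≡⇒≡ᵇ i j i≡j)) , gi
...   | there v∈′ = map₂ (map₁ there) (∈-otherColours⁻ g is v∈′)

update-same : ∀ col {r c} v → update col r c v r c ≡ just v
update-same col {r} {c} v rewrite ≡ᵇ-refl r | ≡ᵇ-refl c = refl

update-other : ∀ col {r₀ c₀ r c} v → ¬ (r ≡ r₀ × c ≡ c₀) → update col r₀ c₀ v r c ≡ col r c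
update-other col {r₀} {c₀} {r} {c} v ≢cell with r ≡ᵇ r₀ in r≟ | c ≡ᵇ c₀ in c≟
... | true  | true  =
  contradiction (≡ᵇ⇒≡ r r₀ (subst T (sym r≟) _) , ≡ᵇ⇒≡ c c₀ (subst T (sym c≟) _)) ≢cell
... | true  | false = refl
... | false | _     = refl

Before : ℕ → ℕ → ℕ → ℕ → Set
Before r c r₀ c₀ = r < r₀ ⊎ (r ≡ r₀ × c < c₀)

Before-suc : ∀ {r c r₀ c₀} → Before r c r₀ (suc c₀) → Before r c r₀ c₀ ⊎ (r ≡ r₀ × c ≡ c₀)
Before-suc (inj₁ r<r₀) = inj₁ (inj₁ r<r₀)
Before-suc (inj₂ (r≡r₀ , c<1+c₀)) with m≤n⇒m<n∨m≡n (s≤s⁻¹ c<1+c₀)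
... | inj₁ c<c₀ = inj₁ (inj₂ (r≡r₀ , c<c₀))
... | inj₂ c≡c₀ = inj₂ (r≡r₀ , c≡c₀)

-- First-Fit

module FirstFit (n : ℕ) (M : ℕ → ℕ → ℕ) (S : CellSet) where

  data Blocked (r c v : ℕ) : Set where
    inRow : ∀ {c′} → c′ < n → c′ ≢ c → M r c′ ≡ v → S r c′ ≡ true ⊎ c′ < c → Blocked r c v
    inCol : ∀ {r′} → r′ < n → r′ ≢ r → M r′ c ≡ v → S r′ c ≡ true ⊎ r′ < r → Blocked r c v

  Forced : ℕ → ℕ → Set
  Forced r c = ∀ {v} → 1 ≤ v → v < M r c → Blocked r c v

  Sound : Coloring → Set
  Sound col = ∀ {r c y} → r < n → c < n → col r c ≡ just y → y ≡ M r c

  Done : Coloring → ℕ → ℕ → Set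
  Done col r₀ c₀ = ∀ {r c} → r < n → c < n →
    S r c ≡ true ⊎ Before r c r₀ c₀ → col r c ≡ just (M r c)

  module _
    (rowInjective : ∀ {r c c′} → r < n → c < n → c′ < n → M r c ≡ M r c′ → c ≡ c′)
    (colInjective : ∀ {r r′ c} → r < n → r′ < n → c < n → M r c ≡ M r′ c → r ≡ r′)
    (positive : ∀ {r c} → r < n → c < n → 1 ≤ M r c)
    (forced : ∀ {r c} → r < n → c < n → S r c ≡ false → Forced r c)
    where

    module _ {col r₀ c₀} (r₀<n : r₀ < n) (c₀<n : c₀ < n)
             (sound : Sound col) (done : Done col r₀ c₀) where

      mex-neighbourColors : S r₀ c₀ ≡ false → mex (neighbourColors n col r₀ c₀) ≡ M r₀ c₀
      mex-neighbourColors free = mex-≡ (neighbourColors n col r₀ c₀) (positive r₀<n c₀<n) seen unseen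
        where
        seen : ∀ {v} → 1 ≤ v → v < M r₀ c₀ → v ∈ neighbourColors n col r₀ c₀
        seen 1≤v v< with forced r₀<n c₀<n free 1≤v v<
        ... | inRow c′<n c′≢c₀ refl earlier =
          ∈-++⁺ˡ (∈-otherColours⁺ (col r₀) (upTo n) (∈-upTo⁺ c′<n) c′≢c₀
            (done r₀<n c′<n (⊎.map₂ (λ c′<c₀ → inj₂ (refl , c′<c₀)) earlier)))
        ... | inCol r′<n r′≢r₀ refl earlier =
          ∈-++⁺ʳ _ (∈-otherColours⁺ (λ r → col r c₀) (upTo n) (∈-upTo⁺ r′<n) r′≢r₀
            (done r′<n c₀<n (⊎.map₂ inj₁ earlier)))
        unseen : M r₀ c₀ ∉ neighbourColors n col r₀ c₀
        unseen m∈ with ∈-++⁻ (otherColours (col r₀) c₀ (upTo n)) m∈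
        ... | inj₁ inRow′
          with c′ , c′∈ , c′≢c₀ , colour ← ∈-otherColours⁻ (col r₀) (upTo n) inRow′ =
          c′≢c₀ (sym (rowInjective r₀<n c₀<n (∈-upTo⁻ c′∈) (sound r₀<n (∈-upTo⁻ c′∈) colour)))
        ... | inj₂ inCol′
          with r′ , r′∈ , r′≢r₀ , colour ← ∈-otherColours⁻ (λ r → col r c₀) (upTo n) inCol′ =
          r′≢r₀ (sym (colInjective r₀<n (∈-upTo⁻ r′∈) c₀<n (sound (∈-upTo⁻ r′∈) c₀<n colour)))

      ffStep-current : ffStep n S col (r₀ , c₀) r₀ c₀ ≡ just (M r₀ c₀)
      ffStep-current with S r₀ c₀ in s₀
      ... | true  = done r₀<n c₀<n (inj₁ s₀)
      ... | false = trans (update-same col _) (cong just (mex-neighbourColors s₀))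

      ffStep-other : ∀ {r c} → ¬ (r ≡ r₀ × c ≡ c₀) → ffStep n S col (r₀ , c₀) r c ≡ col r c
      ffStep-other ≢cell with S r₀ c₀
      ... | true  = refl
      ... | false = update-other col _ ≢cell

      ffStep-sound : Sound (ffStep n S col (r₀ , c₀))
      ffStep-sound {r} {c} r<n c<n col′≡y with (r ≟ r₀) ×-dec (c ≟ c₀)
      ... | yes (refl , refl) = just-injective (trans (sym col′≡y) ffStep-current)
      ... | no ≢cell = sound r<n c<n (trans (sym (ffStep-other ≢cell)) col′≡y)

      ffStep-done : Done (ffStep n S col (r₀ , c₀)) r₀ (suc c₀)
      ffStep-done {r} {c} r<n c<n coloured with (r ≟ r₀) ×-dec (c ≟ c₀)
      ... | yes (refl , refl) = ffStep-current
      ... | no ≢cell = trans (ffStep-other ≢cell) (done r<n c<n (earlier coloured))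
        where
        earlier : S r c ≡ true ⊎ Before r c r₀ (suc c₀) → S r c ≡ true ⊎ Before r c r₀ c₀
        earlier (inj₁ precoloured) = inj₁ precoloured
        earlier (inj₂ before) with Before-suc before
        ... | inj₁ before′ = inj₂ before′
        ... | inj₂ cell = contradiction cell ≢cell

    Invariant : ℕ → ℕ → Coloring → Set
    Invariant r₀ c₀ col = Sound col × Done col r₀ c₀

    scanRow : ∀ {r₀ col} → r₀ < n → Invariant r₀ 0 col →
      Invariant (suc r₀) 0 (foldl (ffStep n S) col (map (r₀ ,_) (upTo n)))
    scanRow {r₀} {col} r₀<n inv rewrite foldl-map (ffStep n S) (r₀ ,_) col (upTo n) =
      map₂ nextRow (foldl-upTo-induction (Invariant r₀) (λ col c → ffStep n S col (r₀ , c)) n inv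
        λ c<n (sound , done) → ffStep-sound r₀<n c<n sound done , ffStep-done r₀<n c<n sound done)
      where
      nextRow : ∀ {col} → Done col r₀ n → Done col (suc r₀) 0
      nextRow done r<n c<n (inj₁ precoloured) = done r<n c<n (inj₁ precoloured)
      nextRow done r<n c<n (inj₂ (inj₁ r<1+r₀)) with m≤n⇒m<n∨m≡n (s≤s⁻¹ r<1+r₀)
      ... | inj₁ r<r₀ = done r<n c<n (inj₂ (inj₁ r<r₀))
      ... | inj₂ r≡r₀ = done r<n c<n (inj₂ (inj₂ (r≡r₀ , c<n)))

    forced⇒isGreedyDefiningSet : IsGreedyDefiningSet n M S
    forced⇒isGreedyDefiningSet r c r<n c<n = proj₂ scanned r<n c<n (inj₂ (inj₁ r<n))
      where
      precolouring : Coloring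
      precolouring r c = if S r c then just (M r c) else nothing
      initial : Invariant 0 0 precolouring
      initial = sound₀ , done₀
        where
        sound₀ : Sound precolouring
        sound₀ {r} {c} _ _ with S r c
        ... | true  = λ { refl → refl }
        ... | false = λ ()
        done₀ : Done precolouring 0 0
        done₀ _ _ (inj₁ precoloured) rewrite precoloured = refl
        done₀ _ _ (inj₂ (inj₁ ()))
        done₀ _ _ (inj₂ (inj₂ (_ , ())))
      scanned : Invariant n 0 (firstFit n M S)
      scanned rewrite foldl-concatMap (ffStep n S) (λ r → map (r ,_) (upTo n)) precolouring (upTo n) =
        foldl-upTo-induction (λ r → Invariant r 0) _ n initial scanRow

-- Base-2^k digits and the squares L_k

digits-< : ∀ N {h h′ l l′} → l < N → h < h′ → h * N + l < h′ * N + l′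
digits-< N {h} {h′} {l} {l′} l<N h<h′ = begin-strict
  h * N + l   <⟨ +-monoʳ-< (h * N) l<N ⟩
  h * N + N   ≡⟨ +-comm (h * N) N ⟩
  suc h * N   ≤⟨ *-monoˡ-≤ N h<h′ ⟩
  h′ * N      ≤⟨ m≤m+n (h′ * N) l′ ⟩
  h′ * N + l′ ∎
  where open ≤-Reasoning

digits-injective : ∀ N {h h′ l l′} → l < N → l′ < N →
  h * N + l ≡ h′ * N + l′ → h ≡ h′ × l ≡ l′
digits-injective N {h} {h′} l<N l′<N eq with <-cmp h h′
... | tri< h<h′ _ _ = contradiction eq (<⇒≢ (digits-< N l<N h<h′))
... | tri> _ _ h>h′ = contradiction (sym eq) (<⇒≢ (digits-< N l′<N h>h′))
... | tri≈ _ refl _ = refl , +-cancelˡ-≡ (h * N) _ _ eq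

digits-bound : ∀ N {A h l} → h < A → l < N → h * N + l < A * N
digits-bound N {A} {h} {l} h<A l<N = subst (h * N + l <_) (+-identityʳ (A * N)) (digits-< N {l′ = 0} l<N h<A)

digitsOf : ∀ a k {i} → i < 2 ^ (a + k) → ∃₂ λ h l → h < 2 ^ a × l < 2 ^ k × i ≡ h * 2 ^ k + l
digitsOf a k {i} i< =
  i / 2 ^ k , i % 2 ^ k , m<n*o⇒m/o<n (subst (i <_) (^-distribˡ-+-* 2 a k) i<) , m%n<n i (2 ^ k) ,
  trans (m≡m%n+[m/n]*n i (2 ^ k)) (+-comm (i % 2 ^ k) _)
  where instance _ = m^n≢0 2 k

/-%-digits : ∀ N .{{_ : NonZero N}} {h l} → l < N → (h * N + l) / N ≡ h × (h * N + l) % N ≡ l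
/-%-digits N {h} {l} l< = digits-injective N (m%n<n (h * N + l) N) l<
  (trans (+-comm _ ((h * N + l) % N)) (sym (m≡m%n+[m/n]*n (h * N + l) N)))

<ᵇ≡true : ∀ {m n} → m < n → (m <ᵇ n) ≡ true
<ᵇ≡true m<n = Equivalence.to T-≡ (<⇒<ᵇ m<n)

<ᵇ≡false : ∀ {m n} → n ≤ m → (m <ᵇ n) ≡ false
<ᵇ≡false {m} {n} n≤m with m <ᵇ n in m<?n
... | true  = contradiction (<ᵇ⇒< m n (subst T (sym m<?n) _)) (≤⇒≯ n≤m)
... | false = refl

module _ (k : ℕ) {i j : ℕ} where

  L-topLeft : i < 2 ^ k → j < 2 ^ k → L (suc k) i j ≡ L k i j + 2 ^ k
  L-topLeft i< j< rewrite <ᵇ≡true i< | <ᵇ≡true j< = refl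

  L-topRight : i < 2 ^ k → 2 ^ k ≤ j → L (suc k) i j ≡ L k i (j ∸ 2 ^ k)
  L-topRight i< j≥ rewrite <ᵇ≡true i< | <ᵇ≡false j≥ = refl

  L-bottomLeft : 2 ^ k ≤ i → j < 2 ^ k → L (suc k) i j ≡ L k (i ∸ 2 ^ k) j
  L-bottomLeft i≥ j< rewrite <ᵇ≡false i≥ | <ᵇ≡true j< = refl

  L-bottomRight : 2 ^ k ≤ i → 2 ^ k ≤ j → L (suc k) i j ≡ L k (i ∸ 2 ^ k) (j ∸ 2 ^ k) + 2 ^ k
  L-bottomRight i≥ j≥ rewrite <ᵇ≡false i≥ | <ᵇ≡false j≥ = refl

L-positive : ∀ k i j → 1 ≤ L k i j
L-positive zero i j = s≤s z≤n
L-positive (suc k) i j with i <ᵇ 2 ^ k | j <ᵇ 2 ^ k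
... | true  | true  = ≤-trans (L-positive k i j) (m≤m+n _ _)
... | true  | false = L-positive k i _
... | false | true  = L-positive k _ j
... | false | false = ≤-trans (L-positive k _ _) (m≤m+n _ _)

L-≤ : ∀ k i j → L k i j ≤ 2 ^ k
L-≤ zero i j = ≤-refl
L-≤ (suc k) i j with i <ᵇ 2 ^ k | j <ᵇ 2 ^ k
... | true  | true  = ≤-trans (+-monoˡ-≤ (2 ^ k) (L-≤ k i j)) (+-monoʳ-≤ (2 ^ k) (m≤m+n (2 ^ k) 0))
... | true  | false = ≤-trans (L-≤ k i _) (m≤m+n _ _)
... | false | true  = ≤-trans (L-≤ k _ j) (m≤m+n _ _)
... | false | false = ≤-trans (+-monoˡ-≤ (2 ^ k) (L-≤ k _ _)) (+-monoʳ-≤ (2 ^ k) (m≤m+n (2 ^ k) 0))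

L-sym : ∀ k i j → L k i j ≡ L k j i
L-sym zero i j = refl
L-sym (suc k) i j with i <ᵇ 2 ^ k | j <ᵇ 2 ^ k
... | true  | true  = cong (_+ 2 ^ k) (L-sym k i j)
... | true  | false = L-sym k i _
... | false | true  = L-sym k _ j
... | false | false = cong (_+ 2 ^ k) (L-sym k _ _)

module _ (a k : ℕ) {h l : ℕ} where

  top-digits : h < 2 ^ a → l < 2 ^ k → h * 2 ^ k + l < 2 ^ (a + k)
  top-digits h< l< = subst (_ <_) (sym (^-distribˡ-+-* 2 a k)) (digits-bound (2 ^ k) h< l<)

  bottom-digits : 2 ^ a ≤ h → 2 ^ (a + k) ≤ h * 2 ^ k + l
  bottom-digits h≥ = subst (_≤ _) (sym (^-distribˡ-+-* 2 a k)) (≤-trans (*-monoˡ-≤ (2 ^ k) h≥) (m≤m+n _ l))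

  bottom-digits-∸ : 2 ^ a ≤ h → h * 2 ^ k + l ∸ 2 ^ (a + k) ≡ (h ∸ 2 ^ a) * 2 ^ k + l
  bottom-digits-∸ h≥ = begin
    h * 2 ^ k + l ∸ 2 ^ (a + k)          ≡⟨ cong (h * 2 ^ k + l ∸_) (^-distribˡ-+-* 2 a k) ⟩
    h * 2 ^ k + l ∸ 2 ^ a * 2 ^ k        ≡⟨ +-∸-comm l (*-monoˡ-≤ (2 ^ k) h≥) ⟩
    h * 2 ^ k ∸ 2 ^ a * 2 ^ k + l        ≡⟨ cong (_+ l) (*-distribʳ-∸ (2 ^ k) h (2 ^ a)) ⟨
    (h ∸ 2 ^ a) * 2 ^ k + l              ∎
    where open ≡-Reasoning

upperHalf-∸< : ∀ a {h} → 2 ^ a ≤ h → h < 2 ^ suc a → h ∸ 2 ^ a < 2 ^ a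
upperHalf-∸< a {h} h≥ h< =
  m<n+o⇒m∸n<o h (2 ^ a) {{m^n≢0 2 a}} (subst (h <_) (cong (2 ^ a +_) (+-identityʳ (2 ^ a))) h<)

raise-high-digit : ∀ N {x} y A → 1 ≤ x → pred x * N + y + A * N ≡ pred (x + A) * N + y
raise-high-digit N {suc x} y A _ = begin
  x * N + y + A * N     ≡⟨ +-assoc (x * N) y (A * N) ⟩
  x * N + (y + A * N)   ≡⟨ cong (x * N +_) (+-comm y (A * N)) ⟩
  x * N + (A * N + y)   ≡⟨ +-assoc (x * N) (A * N) y ⟨
  x * N + A * N + y     ≡⟨ cong (_+ y) (*-distribʳ-+ N x A) ⟨
  (x + A) * N + y       ∎
  where open ≡-Reasoning

L-digits : ∀ a k {h h′ l l′} → h < 2 ^ a → h′ < 2 ^ a → l < 2 ^ k → l′ < 2 ^ k →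
  L (a + k) (h * 2 ^ k + l) (h′ * 2 ^ k + l′) ≡ pred (L a h h′) * 2 ^ k + L k l l′
L-digits zero k {zero} {zero} _ _ _ _ = refl
L-digits zero k {suc _} (s≤s ()) _ _ _
L-digits zero k {h′ = suc _} _ (s≤s ()) _ _
L-digits (suc a) k {h} {h′} {l} {l′} h< h′< l< l′< with h <? 2 ^ a | h′ <? 2 ^ a
... | yes h<ᵃ | yes h′<ᵃ = begin
  L (suc (a + k)) (h * N + l) (h′ * N + l′)
    ≡⟨ L-topLeft (a + k) (top-digits a k h<ᵃ l<) (top-digits a k h′<ᵃ l′<) ⟩
  L (a + k) (h * N + l) (h′ * N + l′) + 2 ^ (a + k)
    ≡⟨ cong₂ _+_ (L-digits a k h<ᵃ h′<ᵃ l< l′<) (^-distribˡ-+-* 2 a k) ⟩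
  pred (L a h h′) * N + L k l l′ + 2 ^ a * N
    ≡⟨ raise-high-digit N (L k l l′) (2 ^ a) (L-positive a h h′) ⟩
  pred (L a h h′ + 2 ^ a) * N + L k l l′
    ≡⟨ cong (λ x → pred x * N + L k l l′) (L-topLeft a h<ᵃ h′<ᵃ) ⟨
  pred (L (suc a) h h′) * N + L k l l′ ∎
  where open ≡-Reasoning; N = 2 ^ k
... | yes h<ᵃ | no h′≮ = begin
  L (suc (a + k)) (h * N + l) (h′ * N + l′)
    ≡⟨ L-topRight (a + k) (top-digits a k h<ᵃ l<) (bottom-digits a k h′≥) ⟩
  L (a + k) (h * N + l) (h′ * N + l′ ∸ 2 ^ (a + k))
    ≡⟨ cong (L (a + k) _) (bottom-digits-∸ a k h′≥) ⟩
  L (a + k) (h * N + l) ((h′ ∸ 2 ^ a) * N + l′)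
    ≡⟨ L-digits a k h<ᵃ (upperHalf-∸< a h′≥ h′<) l< l′< ⟩
  pred (L a h (h′ ∸ 2 ^ a)) * N + L k l l′
    ≡⟨ cong (λ x → pred x * N + L k l l′) (L-topRight a h<ᵃ h′≥) ⟨
  pred (L (suc a) h h′) * N + L k l l′ ∎
  where open ≡-Reasoning; N = 2 ^ k; h′≥ = ≮⇒≥ h′≮
... | no h≮ | yes h′<ᵃ = begin
  L (suc (a + k)) (h * N + l) (h′ * N + l′)
    ≡⟨ L-bottomLeft (a + k) (bottom-digits a k h≥) (top-digits a k h′<ᵃ l′<) ⟩
  L (a + k) (h * N + l ∸ 2 ^ (a + k)) (h′ * N + l′)
    ≡⟨ cong (λ i → L (a + k) i (h′ * N + l′)) (bottom-digits-∸ a k h≥) ⟩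
  L (a + k) ((h ∸ 2 ^ a) * N + l) (h′ * N + l′)
    ≡⟨ L-digits a k (upperHalf-∸< a h≥ h<) h′<ᵃ l< l′< ⟩
  pred (L a (h ∸ 2 ^ a) h′) * N + L k l l′
    ≡⟨ cong (λ x → pred x * N + L k l l′) (L-bottomLeft a h≥ h′<ᵃ) ⟨
  pred (L (suc a) h h′) * N + L k l l′ ∎
  where open ≡-Reasoning; N = 2 ^ k; h≥ = ≮⇒≥ h≮
... | no h≮ | no h′≮ = begin
  L (suc (a + k)) (h * N + l) (h′ * N + l′)
    ≡⟨ L-bottomRight (a + k) (bottom-digits a k h≥) (bottom-digits a k h′≥) ⟩
  L (a + k) (h * N + l ∸ 2 ^ (a + k)) (h′ * N + l′ ∸ 2 ^ (a + k)) + 2 ^ (a + k)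
    ≡⟨ cong₂ (λ i j → L (a + k) i j + 2 ^ (a + k)) (bottom-digits-∸ a k h≥) (bottom-digits-∸ a k h′≥) ⟩
  L (a + k) ((h ∸ 2 ^ a) * N + l) ((h′ ∸ 2 ^ a) * N + l′) + 2 ^ (a + k)
    ≡⟨ cong₂ _+_ (L-digits a k (upperHalf-∸< a h≥ h<) (upperHalf-∸< a h′≥ h′<) l< l′<)
                 (^-distribˡ-+-* 2 a k) ⟩
  pred (L a (h ∸ 2 ^ a) (h′ ∸ 2 ^ a)) * N + L k l l′ + 2 ^ a * N
    ≡⟨ raise-high-digit N (L k l l′) (2 ^ a) (L-positive a _ _) ⟩
  pred (L a (h ∸ 2 ^ a) (h′ ∸ 2 ^ a) + 2 ^ a) * N + L k l l′
    ≡⟨ cong (λ x → pred x * N + L k l l′) (L-bottomRight a h≥ h′≥) ⟨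
  pred (L (suc a) h h′) * N + L k l l′ ∎
  where open ≡-Reasoning; N = 2 ^ k; h≥ = ≮⇒≥ h≮; h′≥ = ≮⇒≥ h′≮

pred-+ : ∀ m {n} → 1 ≤ n → pred (m + n) ≡ m + pred n
pred-+ m {suc n} _ = cong pred (+-suc m n)

L-pred-< : ∀ k i j → pred (L k i j) < 2 ^ k
L-pred-< k i j = ≤-trans (≤-reflexive (suc-pred (L k i j) {{>-nonZero (L-positive k i j)}})) (L-≤ k i j)

pred-injective⁺ : ∀ {m n} → 1 ≤ m → 1 ≤ n → pred m ≡ pred n → m ≡ n
pred-injective⁺ (s≤s _) (s≤s _) = cong suc

L-pred-digits : ∀ a k {h h′ l l′} → h < 2 ^ a → h′ < 2 ^ a → l < 2 ^ k → l′ < 2 ^ k →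
  pred (L (a + k) (h * 2 ^ k + l) (h′ * 2 ^ k + l′)) ≡ pred (L a h h′) * 2 ^ k + pred (L k l l′)
L-pred-digits a k {l = l} {l′} h< h′< l< l′< =
  trans (cong pred (L-digits a k h< h′< l< l′<)) (pred-+ _ (L-positive k l l′))

L-<pred : ∀ k {i j q} → q < pred (L k i j) → suc q < L k i j
L-<pred k {i} {j} = m≤pred[n]⇒suc[m]≤n {{>-nonZero (L-positive k i j)}}

L-digits-suc : ∀ a k {h h′ l l′ x y} → h < 2 ^ a → h′ < 2 ^ a → l < 2 ^ k → l′ < 2 ^ k →
  L a h h′ ≡ suc x → L k l l′ ≡ suc y →
  L (a + k) (h * 2 ^ k + l) (h′ * 2 ^ k + l′) ≡ suc (x * 2 ^ k + y)
L-digits-suc a k h< h′< l< l′< Lₐ≡ Lₖ≡ = pred-injective⁺ (L-positive (a + k) _ _) (s≤s z≤n)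
  (trans (L-pred-digits a k h< h′< l< l′<) (cong₂ (λ u w → pred u * 2 ^ k + pred w) Lₐ≡ Lₖ≡))

RowInjective : ℕ → Set
RowInjective k = ∀ {r c c′} → r < 2 ^ k → c < 2 ^ k → c′ < 2 ^ k → L k r c ≡ L k r c′ → c ≡ c′

RowSurjective : ℕ → Set
RowSurjective k = ∀ {r v} → r < 2 ^ k → 1 ≤ v → v ≤ 2 ^ k → ∃ λ c → c < 2 ^ k × L k r c ≡ v

module _ (a k : ℕ) {r : ℕ} (r< : r < 2 ^ (a + k)) where

  open ≡-Reasoning

  rowInjective-+ : RowInjective a → RowInjective k → ∀ {c c′} → c < 2 ^ (a + k) → c′ < 2 ^ (a + k) →
    L (a + k) r c ≡ L (a + k) r c′ → c ≡ c′
  rowInjective-+ injₐ injₖ c< c′< same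
    with rh , rl , rh< , rl< , refl ← digitsOf a k r<
       | ch , cl , ch< , cl< , refl ← digitsOf a k c<
       | ch′ , cl′ , ch′< , cl′< , refl ← digitsOf a k c′<
    with hi , lo ← digits-injective (2 ^ k) (L-pred-< k rl cl) (L-pred-< k rl cl′) (begin
         pred (L a rh ch) * 2 ^ k + pred (L k rl cl)      ≡⟨ L-pred-digits a k rh< ch< rl< cl< ⟨
         pred (L (a + k) _ _)                              ≡⟨ cong pred same ⟩
         pred (L (a + k) _ _)                              ≡⟨ L-pred-digits a k rh< ch′< rl< cl′< ⟩
         pred (L a rh ch′) * 2 ^ k + pred (L k rl cl′)    ∎)
    = cong₂ (λ h l → h * 2 ^ k + l) 
        (injₐ rh< ch< ch′< (pred-injective⁺ (L-positive a rh ch) (L-positive a rh ch′) hi))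
        (injₖ rl< cl< cl′< (pred-injective⁺ (L-positive k rl cl) (L-positive k rl cl′) lo))

  rowSurjective-+ : RowSurjective a → RowSurjective k → ∀ {v} → 1 ≤ v → v ≤ 2 ^ (a + k) →
    ∃ λ c → c < 2 ^ (a + k) × L (a + k) r c ≡ v
  rowSurjective-+ surₐ surₖ {suc v} 1≤v v<
    with rh , rl , rh< , rl< , refl ← digitsOf a k r<
       | q , s , q< , s< , v≡ ← digitsOf a k v<
    with ch , ch< , Lch ← surₐ rh< (s≤s z≤n) q<
       | cl , cl< , Lcl ← surₖ rl< (s≤s z≤n) s<
    = ch * 2 ^ k + cl , top-digits a k ch< cl< ,
      pred-injective⁺ (L-positive (a + k) _ _) 1≤v (begin
        pred (L (a + k) (rh * 2 ^ k + rl) (ch * 2 ^ k + cl))  ≡⟨ L-pred-digits a k rh< ch< rl< cl< ⟩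
        pred (L a rh ch) * 2 ^ k + pred (L k rl cl)          ≡⟨ cong₂ (λ x y → pred x * 2 ^ k + pred y) Lch Lcl ⟩
        q * 2 ^ k + s                                        ≡⟨ v≡ ⟨
        v                                                    ∎)

rowInjective : ∀ k → RowInjective k
rowInjective zero {c = zero} {zero} _ _ _ _ = refl
rowInjective zero {c = suc _} _ (s≤s ()) _ _
rowInjective zero {c′ = suc _} _ _ (s≤s ()) _
rowInjective (suc k) r< = rowInjective-+ 1 k r< rowInjective₁ (rowInjective k)
  where
  rowInjective₁ : RowInjective 1
  rowInjective₁ {0} {0} {0} _ _ _ _ = refl
  rowInjective₁ {0} {1} {1} _ _ _ _ = refl
  rowInjective₁ {1} {0} {0} _ _ _ _ = refl
  rowInjective₁ {1} {1} {1} _ _ _ _ = refl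
  rowInjective₁ {0} {0} {1} _ _ _ ()
  rowInjective₁ {0} {1} {0} _ _ _ ()
  rowInjective₁ {1} {0} {1} _ _ _ ()
  rowInjective₁ {1} {1} {0} _ _ _ ()
  rowInjective₁ {suc (suc _)} (s≤s (s≤s ())) _ _ _
  rowInjective₁ {c = suc (suc _)} _ (s≤s (s≤s ())) _ _
  rowInjective₁ {c′ = suc (suc _)} _ _ (s≤s (s≤s ())) _

rowSurjective : ∀ k → RowSurjective k
rowSurjective zero {v = 1} _ _ _ = 0 , s≤s z≤n , refl
rowSurjective zero {v = suc (suc _)} _ _ (s≤s ())
rowSurjective (suc k) r< = rowSurjective-+ 1 k r< rowSurjective₁ (rowSurjective k)
  where
  rowSurjective₁ : RowSurjective 1
  rowSurjective₁ {0} {1} _ _ _ = 1 , s≤s (s≤s z≤n) , refl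
  rowSurjective₁ {0} {2} _ _ _ = 0 , s≤s z≤n , refl
  rowSurjective₁ {1} {1} _ _ _ = 0 , s≤s z≤n , refl
  rowSurjective₁ {1} {2} _ _ _ = 1 , s≤s (s≤s z≤n) , refl
  rowSurjective₁ {suc (suc _)} (s≤s (s≤s ())) _ _
  rowSurjective₁ {v = suc (suc (suc _))} _ _ (s≤s (s≤s ()))

colSurjective : ∀ k {c v} → c < 2 ^ k → 1 ≤ v → v ≤ 2 ^ k → ∃ λ r → r < 2 ^ k × L k r c ≡ v
colSurjective k {c} c< 1≤v v≤ with r , r< , Lcr ← rowSurjective k c< 1≤v v≤ =
  r , r< , trans (L-sym k r c) Lcr

-- Blockwise products of forcing sets

blockwise : ℕ → CellSet → CellSet → CellSet
blockwise k P Q r c = P (r / 2 ^ k) (c / 2 ^ k) ∨ Q (r % 2 ^ k) (c % 2 ^ k)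
  where instance _ = m^n≢0 2 k

blockwise-digits : ∀ k P Q {h h′ l l′} → l < 2 ^ k → l′ < 2 ^ k →
  blockwise k P Q (h * 2 ^ k + l) (h′ * 2 ^ k + l′) ≡ P h h′ ∨ Q l l′
blockwise-digits k P Q {h} {h′} {l} {l′} l< l′< =
  cong₂ _∨_ (cong₂ P (row .proj₁) (col .proj₁)) (cong₂ Q (row .proj₂) (col .proj₂))
  where
  row = /-%-digits (2 ^ k) {{m^n≢0 2 k}} {h} l<
  col = /-%-digits (2 ^ k) {{m^n≢0 2 k}} {h′} l′<

open FirstFit using (Blocked; inRow; inCol; Forced)

Forcing : ℕ → CellSet → Set
Forcing k S = ∀ {r c} → r < 2 ^ k → c < 2 ^ k → S r c ≡ false → Forced (2 ^ k) (L k) S r c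

module _ (a k : ℕ) (P Q : CellSet) {rh rl ch cl : ℕ}
         (rh< : rh < 2 ^ a) (rl< : rl < 2 ^ k) (ch< : ch < 2 ^ a) (cl< : cl < 2 ^ k) where

  private
    N = 2 ^ k
    Blocked⁺ = Blocked (2 ^ (a + k)) (L (a + k)) (blockwise k P Q) (rh * N + rl) (ch * N + cl)

  blocked-high : ∀ {q s} → s < N → Blocked (2 ^ a) (L a) P rh ch (suc q) → Blocked⁺ (suc (q * N + s))
  blocked-high s< (inRow {ch′} ch′< ch′≢ch Lch′ earlier)
    with cl′ , cl′< , Lcl′ ← rowSurjective k rl< (s≤s z≤n) s< =
    inRow (top-digits a k ch′< cl′<) (ch′≢ch ∘ proj₁ ∘ digits-injective N cl′< cl<)
      (L-digits-suc a k rh< ch′< rl< cl′< Lch′ Lcl′)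
      (⊎.map (λ Pch′ → trans (blockwise-digits k P Q rl< cl′<) (cong (_∨ _) Pch′)) (digits-< N cl′<) earlier)
  blocked-high s< (inCol {rh′} rh′< rh′≢rh Lrh′ earlier)
    with rl′ , rl′< , Lrl′ ← colSurjective k cl< (s≤s z≤n) s< =
    inCol (top-digits a k rh′< rl′<) (rh′≢rh ∘ proj₁ ∘ digits-injective N rl′< rl<)
      (L-digits-suc a k rh′< ch< rl′< cl< Lrh′ Lrl′)
      (⊎.map (λ Prh′ → trans (blockwise-digits k P Q rl′< cl<) (cong (_∨ _) Prh′)) (digits-< N rl′<) earlier)

  blocked-low : ∀ {q s} → L a rh ch ≡ suc q → Blocked N (L k) Q rl cl (suc s) → Blocked⁺ (suc (q * N + s))
  blocked-low Lch (inRow {cl′} cl′< cl′≢cl Lcl′ earlier) =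
    inRow (top-digits a k ch< cl′<) (cl′≢cl ∘ proj₂ ∘ digits-injective N {ch} {ch} cl′< cl<)
      (L-digits-suc a k rh< ch< rl< cl′< Lch Lcl′)
      (⊎.map (λ Qcl′ → trans (blockwise-digits k P Q rl< cl′<) (trans (cong (P rh ch ∨_) Qcl′) (∨-zeroʳ _)))
                    (+-monoʳ-< (ch * N)) earlier)
  blocked-low Lch (inCol {rl′} rl′< rl′≢rl Lrl′ earlier) =
    inCol (top-digits a k rh< rl′<) (rl′≢rl ∘ proj₂ ∘ digits-injective N {rh} {rh} rl′< rl<)
      (L-digits-suc a k rh< ch< rl′< cl< Lch Lrl′)
      (⊎.map (λ Qrl′ → trans (blockwise-digits k P Q rl′< cl<) (trans (cong (P rh ch ∨_) Qrl′) (∨-zeroʳ _)))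
                    (+-monoʳ-< (rh * N)) earlier)

  below : ∀ q s → suc (q * N + s) < L (a + k) (rh * N + rl) (ch * N + cl) →
    q * N + s < pred (L a rh ch) * N + pred (L k rl cl)
  below q s v< = subst (q * N + s <_) (L-pred-digits a k rh< ch< rl< cl<) (<⇒≤pred v<)

  -- Write the colour as q·2^k + s + 1. If q + 1 is below the high digit of the cell, the colour is
  -- blocked by a lift of the L_a-witness for q + 1, whose low digit s + 1 exists by surjectivity of
  -- the rows of L_k; if q + 1 is the high digit, by a lift of the L_k-witness for s + 1.
  blocked-digits : Forcing a P → Forcing k Q → P rh ch ≡ false → Q rl cl ≡ false → ∀ {q s} → s < N →
    suc (q * N + s) < L (a + k) (rh * N + rl) (ch * N + cl) → Blocked⁺ (suc (q * N + s))
  blocked-digits forcingₐ forcingₖ freeₐ freeₖ {q} {s} s< v< with <-cmp q (pred (L a rh ch))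
  ... | tri< q<x _ _ = blocked-high s< (forcingₐ rh< ch< freeₐ (s≤s z≤n) (L-<pred a q<x))
  ... | tri≈ _ refl _ = blocked-low (sym (suc-pred _ {{>-nonZero (L-positive a rh ch)}}))
          (forcingₖ rl< cl< freeₖ (s≤s z≤n) (L-<pred k (+-cancelˡ-< _ _ _ (below q s v<))))
  ... | tri> _ _ q>x = contradiction (below q s v<) (<⇒≯ (digits-< N (L-pred-< k rl cl) q>x))

forcing-blockwise : ∀ a k {P Q} → Forcing a P → Forcing k Q → Forcing (a + k) (blockwise k P Q)
forcing-blockwise a k {P} {Q} forcingₐ forcingₖ r< c< free {suc v} _ v<
  with rh , rl , rh< , rl< , refl ← digitsOf a k r<
     | ch , cl , ch< , cl< , refl ← digitsOf a k c<
  with q , s , _ , s< , refl ← digitsOf a k (<-trans (n<1+n v) (<-≤-trans v< (L-≤ (a + k) _ _)))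
  with free′ ← trans (sym (blockwise-digits k P Q {rh} {ch} rl< cl<)) free =
  blocked-digits a k P Q rh< rl< ch< cl< forcingₐ forcingₖ
    (∨-conicalˡ _ _ free′) (∨-conicalʳ _ _ free′) {q} s< v<

-- Forcing sets of L_k and their free cells

all-upTo⁻ : ∀ (p : ℕ → Bool) {n i} → T (all p (upTo n)) → i < n → T (p i)
all-upTo⁻ p {n} holds i<n = All.lookup (all⁺ p (upTo n) holds) (∈-upTo⁺ i<n)

any-upTo⁻ : ∀ (p : ℕ → Bool) {n} → T (any p (upTo n)) → ∃ λ i → i < n × T (p i)
any-upTo⁻ p {n} holds with i , i∈ , pi ← find (any⁻ p (upTo n) holds) = i , ∈-upTo⁻ i∈ , pi

T-≢ᵇ : ∀ {m n} → T (not (m ≡ᵇ n)) → m ≢ n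
T-≢ᵇ {m} t refl rewrite ≡ᵇ-refl m = t

T-∨-<ᵇ : ∀ {b m n} → T (b ∨ (m <ᵇ n)) → b ≡ true ⊎ m < n
T-∨-<ᵇ {true} _ = inj₁ refl
T-∨-<ᵇ {false} {m} {n} t = inj₂ (<ᵇ⇒< m n t)

module _ (n : ℕ) (M : ℕ → ℕ → ℕ) (S : CellSet) where

  blocked? : ℕ → ℕ → ℕ → Bool
  blocked? r c v =
    any (λ c′ → not (c′ ≡ᵇ c) ∧ (M r c′ ≡ᵇ v) ∧ (S r c′ ∨ (c′ <ᵇ c))) (upTo n) ∨
    any (λ r′ → not (r′ ≡ᵇ r) ∧ (M r′ c ≡ᵇ v) ∧ (S r′ c ∨ (r′ <ᵇ r))) (upTo n)

  forcing? : Bool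
  forcing? = all (λ r → all (λ c → S r c ∨ all (λ v → blocked? r c (suc v)) (upTo (pred (M r c))))
                             (upTo n))
                 (upTo n)

  blocked?-sound : ∀ {r c v} → T (blocked? r c v) → Blocked n M S r c v
  blocked?-sound {r} {c} {v} holds with Equivalence.to T-∨ holds
  ... | inj₁ inRow? with c′ , c′< , t ← any-upTo⁻ _ inRow?
                     with c′≢c , t′ ← Equivalence.to T-∧ t
                     with M≡v , earlier ← Equivalence.to T-∧ t′ =
    inRow c′< (T-≢ᵇ c′≢c) (≡ᵇ⇒≡ _ _ M≡v) (T-∨-<ᵇ earlier)
  ... | inj₂ inCol? with r′ , r′< , t ← any-upTo⁻ _ inCol?
                     with r′≢r , t′ ← Equivalence.to T-∧ t
                     with M≡v , earlier ← Equivalence.to T-∧ t′ =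
    inCol r′< (T-≢ᵇ r′≢r) (≡ᵇ⇒≡ _ _ M≡v) (T-∨-<ᵇ earlier)

  forcing?-sound : T forcing? → ∀ {r c} → r < n → c < n → S r c ≡ false → Forced n M S r c
  forcing?-sound holds {r} {c} r< c< free {suc v} _ v<
    with S r c | all-upTo⁻ _ (all-upTo⁻ _ holds r<) c<
  ... | true  | _          = contradiction free λ ()
  ... | false | allBlocked = blocked?-sound (all-upTo⁻ _ allBlocked (<⇒≤pred v<))

-- The free cells of the forcing set of L_3: 33 of the 64, whence the exponent log₈ 33 > 1.673.
freeColumns₃ : ℕ → List ℕ
freeColumns₃ 0 = 0 ∷ 1 ∷ 3 ∷ []
freeColumns₃ 1 = 2 ∷ 3 ∷ 4 ∷ 7 ∷ []
freeColumns₃ 2 = 0 ∷ 2 ∷ 3 ∷ 7 ∷ []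
freeColumns₃ 3 = 3 ∷ 4 ∷ 5 ∷ 6 ∷ []
freeColumns₃ 4 = 0 ∷ 4 ∷ 5 ∷ 6 ∷ []
freeColumns₃ 5 = 1 ∷ 2 ∷ 6 ∷ 7 ∷ []
freeColumns₃ 6 = 0 ∷ 2 ∷ 5 ∷ 6 ∷ 7 ∷ []
freeColumns₃ 7 = 0 ∷ 1 ∷ 3 ∷ 4 ∷ 7 ∷ []
freeColumns₃ _ = []

definingSet₃ : CellSet
definingSet₃ r c = not (c ∈ᵇ freeColumns₃ r)

definingSet : ℕ → CellSet
definingSet (suc (suc (suc k))) = blockwise k definingSet₃ (definingSet k)
definingSet _ r c = not ((r ≡ᵇ 0) ∧ (c ≡ᵇ 0))

forcing-definingSet : ∀ k → Forcing k (definingSet k)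
forcing-definingSet 0 = forcing?-sound 1 (L 0) (definingSet 0) _
forcing-definingSet 1 = forcing?-sound 2 (L 1) (definingSet 1) _
forcing-definingSet 2 = forcing?-sound 4 (L 2) (definingSet 2) _
forcing-definingSet (suc (suc (suc k))) =
  forcing-blockwise 3 k (forcing?-sound 8 (L 3) definingSet₃ _) (forcing-definingSet k)

isGreedyDefiningSet-definingSet : ∀ k → IsGreedyDefiningSet (2 ^ k) (L k) (definingSet k)
isGreedyDefiningSet-definingSet k = FirstFit.forced⇒isGreedyDefiningSet (2 ^ k) (L k) (definingSet k)
  (rowInjective k)
  (λ {r} {r′} {c} r< r′< c< Lrc≡ →
    rowInjective k c< r< r′< (trans (L-sym k c r) (trans Lrc≡ (L-sym k r′ c))))
  (λ {r} {c} _ _ → L-positive k r c)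
  (forcing-definingSet k)

indicator : Bool → ℕ
indicator b = if b then 1 else 0

indicator-+-not : ∀ b → indicator b + indicator (not b) ≡ 1
indicator-+-not true = refl
indicator-+-not false = refl

indicator-not-∨ : ∀ a b → indicator (not (a ∨ b)) ≡ indicator (not a) * indicator (not b)
indicator-not-∨ true b = refl
indicator-not-∨ false true = refl
indicator-not-∨ false false = refl

Σ< : ℕ → (ℕ → ℕ) → ℕ
Σ< n f = sum (applyUpTo f n)

Σ<-cong : ∀ n {f g} → (∀ {i} → i < n → f i ≡ g i) → Σ< n f ≡ Σ< n g
Σ<-cong zero f≡g = refl
Σ<-cong (suc n) f≡g = cong₂ _+_ (f≡g z<s) (Σ<-cong n (f≡g ∘ s<s))

Σ<-+ : ∀ n f g → Σ< n (λ i → f i + g i) ≡ Σ< n f + Σ< n g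
Σ<-+ zero f g = refl
Σ<-+ (suc n) f g = trans (cong (f 0 + g 0 +_) (Σ<-+ n (f ∘ suc) (g ∘ suc))) (+-interchange (f 0) (g 0) _ _)

Σ<-const : ∀ n x → Σ< n (λ _ → x) ≡ n * x
Σ<-const zero x = refl
Σ<-const (suc n) x = cong (x +_) (Σ<-const n x)

Σ<-*ˡ : ∀ n x f → Σ< n (λ i → x * f i) ≡ x * Σ< n f
Σ<-*ˡ zero x f = sym (*-zeroʳ x)
Σ<-*ˡ (suc n) x f = trans (cong (x * f 0 +_) (Σ<-*ˡ n x (f ∘ suc))) (sym (*-distribˡ-+ x (f 0) _))

Σ<-*-Σ< : ∀ m n f g → Σ< m (λ i → Σ< n (λ j → f i * g j)) ≡ Σ< m f * Σ< n g
Σ<-*-Σ< m n f g = begin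
  Σ< m (λ i → Σ< n (λ j → f i * g j))   ≡⟨ Σ<-cong m (λ {i} _ → Σ<-*ˡ n (f i) g) ⟩
  Σ< m (λ i → f i * Σ< n g)             ≡⟨ Σ<-cong m (λ {i} _ → *-comm (f i) _) ⟩
  Σ< m (λ i → Σ< n g * f i)             ≡⟨ Σ<-*ˡ m (Σ< n g) f ⟩
  Σ< n g * Σ< m f                       ≡⟨ *-comm (Σ< n g) _ ⟩
  Σ< m f * Σ< n g                       ∎
  where open ≡-Reasoning

Σ<-+-split : ∀ m n f → Σ< (m + n) f ≡ Σ< m f + Σ< n (λ i → f (m + i))
Σ<-+-split zero n f = refl
Σ<-+-split (suc m) n f = trans (cong (f 0 +_) (Σ<-+-split m n (f ∘ suc))) (sym (+-assoc (f 0) _ _))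

Σ<-digits : ∀ A N f → Σ< (A * N) f ≡ Σ< A (λ h → Σ< N (λ l → f (h * N + l)))
Σ<-digits zero N f = refl
Σ<-digits (suc A) N f = begin
  Σ< (N + A * N) f
    ≡⟨ Σ<-+-split N (A * N) f ⟩
  Σ< N f + Σ< (A * N) (λ i → f (N + i))
    ≡⟨ cong (Σ< N f +_) (Σ<-digits A N (λ i → f (N + i))) ⟩
  Σ< N f + Σ< A (λ h → Σ< N (λ l → f (N + (h * N + l))))
    ≡⟨ cong (Σ< N f +_) (Σ<-cong A λ _ → Σ<-cong N λ {l} _ → cong f (sym (+-assoc N _ l))) ⟩
  Σ< (suc A) (λ h → Σ< N (λ l → f (h * N + l)))
    ∎
  where open ≡-Reasoning

sum-concatMap : ∀ {A : Set} (f : A → List ℕ) xs → sum (concatMap f xs) ≡ sum (map (sum ∘ f) xs)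
sum-concatMap f [] = refl
sum-concatMap f (x ∷ xs) = trans (sum-++ (f x) (concatMap f xs)) (cong (sum (f x) +_) (sum-concatMap f xs))

card-Σ< : ∀ n S → card n S ≡ Σ< n (λ r → Σ< n (λ c → indicator (S r c)))
card-Σ< n S = begin
  sum (map cell (concatMap row (upTo n)))                 ≡⟨ cong sum (map-concatMap cell row (upTo n)) ⟩
  sum (concatMap (map cell ∘ row) (upTo n))               ≡⟨ sum-concatMap (map cell ∘ row) (upTo n) ⟩
  sum (map (sum ∘ map cell ∘ row) (upTo n))               ≡⟨ cong sum (map-upTo _ n) ⟩
  Σ< n (sum ∘ map cell ∘ row)                             ≡⟨ Σ<-cong n (λ _ → cong sum inner) ⟩
  Σ< n (λ r → Σ< n (λ c → indicator (S r c)))             ∎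
  where
  open ≡-Reasoning
  cell : ℕ × ℕ → ℕ
  cell (r , c) = indicator (S r c)
  row : ℕ → List (ℕ × ℕ)
  row r = map (r ,_) (upTo n)
  inner : ∀ {r} → map cell (row r) ≡ applyUpTo (λ c → indicator (S r c)) n
  inner = trans (sym (map-∘ (upTo n))) (map-upTo _ n)

freeCount : ℕ → CellSet → ℕ
freeCount n S = Σ< n (λ r → Σ< n (λ c → indicator (not (S r c))))

card+freeCount : ∀ n S → card n S + freeCount n S ≡ n * n
card+freeCount n S = begin
  card n S + freeCount n S
    ≡⟨ cong (_+ freeCount n S) (card-Σ< n S) ⟩
  Σ< n (λ r → Σ< n (λ c → indicator (S r c))) + freeCount n S
    ≡⟨ Σ<-+ n _ _ ⟨
  Σ< n (λ r → Σ< n (λ c → indicator (S r c)) + Σ< n (λ c → indicator (not (S r c))))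
    ≡⟨ Σ<-cong n (λ {r} _ → row r) ⟩
  Σ< n (λ _ → n)
    ≡⟨ Σ<-const n n ⟩
  n * n ∎
  where
  open ≡-Reasoning
  row : ∀ r → Σ< n (λ c → indicator (S r c)) + Σ< n (λ c → indicator (not (S r c))) ≡ n
  row r = begin
    Σ< n (λ c → indicator (S r c)) + Σ< n (λ c → indicator (not (S r c)))  ≡⟨ Σ<-+ n _ _ ⟨
    Σ< n (λ c → indicator (S r c) + indicator (not (S r c)))               ≡⟨ Σ<-cong n (λ {c} _ →
                                                                                indicator-+-not (S r c)) ⟩
    Σ< n (λ _ → 1)                                                         ≡⟨ Σ<-const n 1 ⟩
    n * 1                                                                  ≡⟨ *-identityʳ n ⟩
    n                                                                      ∎

^2∸card≡freeCount : ∀ n S → n ^ 2 ∸ card n S ≡ freeCount n S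
^2∸card≡freeCount n S = begin
  n ^ 2 ∸ card n S                     ≡⟨ cong (λ m → n * m ∸ card n S) (*-identityʳ n) ⟩
  n * n ∸ card n S                     ≡⟨ cong (_∸ card n S) (card+freeCount n S) ⟨
  card n S + freeCount n S ∸ card n S  ≡⟨ m+n∸m≡n (card n S) _ ⟩
  freeCount n S                        ∎
  where open ≡-Reasoning

freeCount-blockwise : ∀ a k P Q →
  freeCount (2 ^ (a + k)) (blockwise k P Q) ≡ freeCount (2 ^ a) P * freeCount (2 ^ k) Q
freeCount-blockwise a k P Q = begin
  freeCount (2 ^ (a + k)) B
    ≡⟨ cong (λ n → freeCount n B) (^-distribˡ-+-* 2 a k) ⟩
  Σ< (A * N) (λ r → Σ< (A * N) (λ c → indicator (not (B r c))))
    ≡⟨ Σ<-digits A N _ ⟩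
  Σ< A (λ h → Σ< N (λ l → Σ< (A * N) (λ c → indicator (not (B (h * N + l) c)))))
    ≡⟨ Σ<-cong A (λ {h} _ → Σ<-cong N λ {l} l< → trans (Σ<-digits A N _) (Σ<-cong A λ {h′} _ → Σ<-cong N λ {l′} l′< →
         trans (cong (indicator ∘ not) (blockwise-digits k P Q {h} {h′} l< l′<))
               (indicator-not-∨ (P h h′) (Q l l′)))) ⟩
  Σ< A (λ h → Σ< N (λ l → Σ< A (λ h′ → Σ< N (λ l′ → indicator (not (P h h′)) * indicator (not (Q l l′))))))
    ≡⟨ Σ<-cong A (λ _ → Σ<-cong N λ _ → Σ<-*-Σ< A N _ _) ⟩
  Σ< A (λ h → Σ< N (λ l → Σ< A (λ h′ → indicator (not (P h h′))) * Σ< N (λ l′ → indicator (not (Q l l′)))))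
    ≡⟨ Σ<-*-Σ< A N _ _ ⟩
  freeCount A P * freeCount N Q
    ∎
  where
  open ≡-Reasoning
  A = 2 ^ a
  N = 2 ^ k
  B = blockwise k P Q

freeCount-definingSet : ∀ k →
  freeCount (2 ^ (3 + k)) (definingSet (3 + k)) ≡ 33 * freeCount (2 ^ k) (definingSet k)
freeCount-definingSet k = freeCount-blockwise 3 k definingSet₃ (definingSet k)

^-distribʳ-* : ∀ m n o → (m * n) ^ o ≡ m ^ o * n ^ o
^-distribʳ-* m n zero = refl
^-distribʳ-* m n (suc o) = trans (cong (m * n *_) (^-distribʳ-* m n o)) (*-interchange m n (m ^ o) (n ^ o))

^-step : ∀ {a b e f c x y} → a ^ e ≤ b ^ f → x ^ e ≤ c * y ^ f → (a * x) ^ e ≤ c * (b * y) ^ f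
^-step {a} {b} {e} {f} {c} {x} {y} aᵉ≤bᶠ xᵉ≤ = begin
  (a * x) ^ e          ≡⟨ ^-distribʳ-* a x e ⟩
  a ^ e * x ^ e        ≤⟨ *-mono-≤ aᵉ≤bᶠ xᵉ≤ ⟩
  b ^ f * (c * y ^ f)  ≡⟨ x∙yz≈y∙xz (b ^ f) c (y ^ f) ⟩
  c * (b ^ f * y ^ f)  ≡⟨ cong (c *_) (^-distribʳ-* b y f) ⟨
  c * (b * y) ^ f      ∎
  where open ≤-Reasoning

8^1673≤33^1000 : 8 ^ 1673 ≤ 33 ^ 1000
8^1673≤33^1000 = ≤ᵇ⇒≤ (8 ^ 1673) (33 ^ 1000) _

-- The exponents are variables so that Agda never unfolds powers such as (2 ^ k) ^ 1673;
-- for the same reason they are passed explicitly below.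
module _ {e f c : ℕ} (8ᵉ≤33ᶠ : 8 ^ e ≤ 33 ^ f)
         (base : ∀ {s} → s < 3 → (2 ^ s) ^ e ≤ c * freeCount (2 ^ s) (definingSet s) ^ f) where

  freeCount-growth : ∀ k → (2 ^ k) ^ e ≤ c * freeCount (2 ^ k) (definingSet k) ^ f
  freeCount-growth 0 = base (s≤s z≤n)
  freeCount-growth 1 = base (s≤s (s≤s z≤n))
  freeCount-growth 2 = base (s≤s (s≤s (s≤s z≤n)))
  freeCount-growth (suc (suc (suc k))) =
    subst₂ (λ n m → n ^ e ≤ c * m ^ f) (sym (^-distribˡ-+-* 2 3 k)) (sym (freeCount-definingSet k))
      (^-step {8} {33} {e} {f} {c} {2 ^ k} {freeCount (2 ^ k) (definingSet k)} 8ᵉ≤33ᶠ (freeCount-growth k))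

^2∸card-bound : ∀ {e f c} n S → n ^ e ≤ c * freeCount n S ^ f → n ^ e ≤ c * (n ^ 2 ∸ card n S) ^ f
^2∸card-bound {e} {f} {c} n S = subst (λ m → n ^ e ≤ c * m ^ f) (sym (^2∸card≡freeCount n S))

theorem12 : ∃ λ (m : ℕ) → ∃ λ (k₀ : ℕ) → ∀ (k : ℕ) → k₀ ≤ k →
    Σ CellSet λ S → IsGreedyDefiningSet (2 ^ k) (L k) S
      × ((2 ^ k) ^ 1673 ≤ m ^ 1000 * ((2 ^ k) ^ 2 ∸ card (2 ^ k) S) ^ 1000)
theorem12 = 16 , 0 , λ k _ → definingSet k , isGreedyDefiningSet-definingSet k ,
  ^2∸card-bound {1673} {1000} {16 ^ 1000} (2 ^ k) (definingSet k)
    (freeCount-growth {1673} {1000} {16 ^ 1000} 8^1673≤33^1000 base k)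
  where
  base : ∀ {s} → s < 3 → (2 ^ s) ^ 1673 ≤ 16 ^ 1000 * freeCount (2 ^ s) (definingSet s) ^ 1000
  base {0} _ = ≤ᵇ⇒≤ ((2 ^ 0) ^ 1673) (16 ^ 1000 * freeCount (2 ^ 0) (definingSet 0) ^ 1000) _
  base {1} _ = ≤ᵇ⇒≤ ((2 ^ 1) ^ 1673) (16 ^ 1000 * freeCount (2 ^ 1) (definingSet 1) ^ 1000) _
  base {2} _ = ≤ᵇ⇒≤ ((2 ^ 2) ^ 1673) (16 ^ 1000 * freeCount (2 ^ 2) (definingSet 2) ^ 1000) _
  base {suc (suc (suc _))} (s≤s (s≤s (s≤s ())))
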